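{- Let $G$ be a finite cyclic group, let $k\in \mathbb N$, and let $S$ be a zero-sum sequence over $G$ of length $\mathsf D_k(G)$. Then $S\in \mathcal M_k(G)$ if and only if there exists $g\in G$ with $\ord(g)=|G|$ such that $S=g^{k|G|}$.
   Context: A sequence over $G$ is a finite unordered sequence of elements of $G$ with repetition allowed, written multiplicatively ($g^m$ is $m$ copies of $g$); it is zero-sum if its terms sum to $0$. $\mathsf D_k(G)$ is the smallest integer $\ell$ such that every sequence over $G$ of length at least $\ell$ has $k$ disjoint nontrivial zero-sum subsequences. $\mathcal M_k(G)$ is the set of zero-sum sequences over $G$ that cannot be partitioned into $k+1$ nontrivial zero-sum subsequences. -}

module Defs where

open import Data.Nat using (ℕ; zero; suc; _+_; _*_; _≤_; _<_; _≥_)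
open import Data.Nat.Divisibility using (_∣_)
open import Data.Fin using (Fin; toℕ)
open import Data.Nat.ListAction using (sum)
open import Data.List using (List; []; _∷_; length; map; concat; _++_; replicate)
open import Data.List.Relation.Unary.All using (All)
open import Data.List.Relation.Binary.Permutation.Propositional using (_↭_)
open import Data.Product using (Σ; ∃; ∃-syntax; _×_; _,_)
open import Relation.Binary.PropositionalEquality using (_≡_; _≢_)
open import Relation.Nullary using (¬_)

-- The finite cyclic group of order n is modelled as ℤ/nℤ, with carrier
-- Fin n (residues 0 … n-1) and addition modulo n.

-- A sequence over ℤ/nℤ: a finite unordered sequence, modelled as a list
-- considered up to permutation (_↭_).
Seq : ℕ → Set
Seq n = List (Fin n)

-- σ(S) = 0 in ℤ/nℤ  ⇔  n divides the sum of the representatives.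
ZeroSum : ∀ {n} → Seq n → Set
ZeroSum {n} S = n ∣ sum (map toℕ S)

NonTrivial : ∀ {n} → Seq n → Set
NonTrivial S = S ≢ []

NTZS : ∀ {n} → Seq n → Set
NTZS S = NonTrivial S × ZeroSum S

HasDisjointZS : ∀ {n} → ℕ → Seq n → Set
HasDisjointZS {n} k S =
  ∃[ Ts ] ∃[ R ] (length Ts ≡ k × All NTZS Ts × S ↭ (concat Ts ++ R))

DkProperty : ℕ → ℕ → ℕ → Set
DkProperty n k ℓ = (S : Seq n) → length S ≥ ℓ → HasDisjointZS k S

IsDk : ℕ → ℕ → ℕ → Set
IsDk n k ℓ = DkProperty n k ℓ × (∀ ℓ' → DkProperty n k ℓ' → ℓ ≤ ℓ')

PartitionableInto : ∀ {n} → ℕ → Seq n → Set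
PartitionableInto {n} m S =
  ∃[ Ts ] (length Ts ≡ m × All NTZS Ts × S ↭ concat Ts)

InMk : ∀ {n} → ℕ → Seq n → Set
InMk k S = ZeroSum S × ¬ PartitionableInto (suc k) S

MulZero : ∀ {n} → ℕ → Fin n → Set
MulZero {n} m g = n ∣ m * toℕ g

HasOrder : ∀ {n} → Fin n → ℕ → Set
HasOrder g m = 1 ≤ m × MulZero m g × (∀ m' → 1 ≤ m' → MulZero m' g → m ≤ m')

-- A sequence of length ≥ n over ℤ/nℤ either has a nonempty zero-sum
-- subsequence of length < n, or it is a power of a generator g (a non-generator
-- g would give the short block g^{ord g}); for a non-constant sequence the
-- short subsequence comes from pigeonhole on prefix sums. Removing short blocks and inducting on k, a
-- zero-sum sequence of length ≥ kn that cannot be cut into k+1 zero-sum blocks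
-- must be g^{kn}. Conversely every nonempty zero-sum power of a generator has
-- length ≥ n, so g^{kn} has at most k disjoint zero-sum blocks; applied to g^ℓ
-- the same count gives D_k(ℤ/nℤ) ≥ kn.
module Submission where

open import Defs
open import Data.Nat using (ℕ; zero; suc; _+_; _*_; _∸_; _≤_; _<_; z≤n; s≤s; s≤s⁻¹; _≤?_; _⊓_; NonZero; >-nonZero; >-nonZero⁻¹)
open import Data.Nat.Properties hiding (_≟_)
open import Data.Nat.Divisibility using (_∣_; divides; quotient; _∣?_; ∣-refl; ∣m+n∣m⇒∣n; ∣m⇒∣m*n; ∣⇒≤; m∣m*n; n∣m*n; n∣m*n*o; m%n≡0⇒n∣m; m∣n⇒n≡quotient*m; 1∣_)
open import Data.Nat.DivMod using (_%_; _/_; _mod_; m≡m%n+[m/n]*n; m%n<n; m<n⇒m%n≡m)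
open import Data.Nat.ListAction using (sum)
open import Data.Nat.ListAction.Properties using (sum-++; sum-↭)
open import Data.Fin using (Fin; toℕ; fromℕ<; zero; suc) renaming (_<_ to _<ᶠ_)
open import Data.Fin.Properties using (pigeonhole; toℕ-fromℕ<; toℕ-injective; toℕ<n; any?; _≟_)
open import Data.List using (List; []; _∷_; [_]; length; map; concat; _++_; take; drop; replicate)
open import Data.List.Properties using (map-++; length-++; length-take; length-drop; take-take; take++drop≡id; ++-identityʳ; ++-assoc; length-replicate)
open import Data.List.Relation.Unary.All using (All; []; _∷_)
open import Data.List.Relation.Unary.All.Properties using (concat⁻; ++⁻ˡ; replicate⁺)
open import Data.List.Relation.Binary.Permutation.Propositional using (_↭_; prep; swap; ↭-refl; ↭-sym; ↭-trans; ↭-reflexive)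
open import Data.List.Relation.Binary.Permutation.Propositional.Properties using (All-resp-↭; ↭-length; ++⁺ˡ; shifts; map⁺)
open import Data.Product using (∃; ∃₂; ∃-syntax; _×_; _,_)
import Data.Product as Product
open import Data.Sum using (_⊎_; inj₁; inj₂; [_,_]′)
import Data.Sum as Sum
open import Function using (_∘_; id; flip)
open import Function.Bundles using (_⇔_; mk⇔)
open import Relation.Binary.Definitions using (DecidableEquality)
open import Relation.Binary.PropositionalEquality using (_≡_; _≢_; refl; sym; trans; cong; subst; module ≡-Reasoning)
open import Relation.Nullary using (yes; no; contradiction)
open import Relation.Nullary.Decidable using (_×-dec_)

σ : ∀ {n} → Seq n → ℕ
σ S = sum (map toℕ S)

σ-++ : ∀ {n} (S T : Seq n) → σ (S ++ T) ≡ σ S + σ T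
σ-++ S T = trans (cong sum (map-++ toℕ S T)) (sum-++ (map toℕ S) (map toℕ T))

σ-↭ : ∀ {n} {S T : Seq n} → S ↭ T → σ S ≡ σ T
σ-↭ S↭T = sum-↭ (map⁺ toℕ S↭T)

σ-replicate : ∀ {n} m (g : Fin n) → σ (replicate m g) ≡ m * toℕ g
σ-replicate zero    g = refl
σ-replicate (suc m) g = cong (toℕ g +_) (σ-replicate m g)

ZeroSum-++⁻ʳ : ∀ {n} (S : Seq n) {T : Seq n} → ZeroSum S → ZeroSum (S ++ T) → ZeroSum T
ZeroSum-++⁻ʳ S {T} zsS zsST = ∣m+n∣m⇒∣n (subst (_ ∣_) (σ-++ S T) zsST) zsS

ZeroSum-replicate : ∀ {n m} (g : Fin n) → n ∣ m → ZeroSum (replicate m g)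
ZeroSum-replicate {n} {m} g n∣m = subst (n ∣_) (sym (σ-replicate m g)) (∣m⇒∣m*n (toℕ g) n∣m)

partition-resp-↭ : ∀ {n m} {S S′ : Seq n} → S ↭ S′ → PartitionableInto m S′ → PartitionableInto m S
partition-resp-↭ S↭S′ (Ts , |Ts|≡m , ntzs , S′↭) = Ts , |Ts|≡m , ntzs , ↭-trans S↭S′ S′↭

partition-singleton : ∀ {n} {S : Seq n} → NTZS S → PartitionableInto 1 S
partition-singleton {S = S} ntzs = [ S ] , refl , ntzs ∷ [] , ↭-reflexive (sym (++-identityʳ S))

partition-∷ : ∀ {n m} {T R : Seq n} → NTZS T → PartitionableInto m R → PartitionableInto (suc m) (T ++ R)
partition-∷ {T = T} ntzsT (Ts , |Ts|≡m , ntzs , R↭) = T ∷ Ts , cong suc |Ts|≡m , ntzsT ∷ ntzs , ++⁺ˡ T R↭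

partition⇒disjointZS : ∀ {n m} {S : Seq n} → PartitionableInto m S → HasDisjointZS m S
partition⇒disjointZS (Ts , |Ts|≡m , ntzs , S↭) =
  Ts , [] , |Ts|≡m , ntzs , ↭-trans S↭ (↭-reflexive (sym (++-identityʳ _)))

replicate-+ : ∀ {A : Set} m n (x : A) → replicate (m + n) x ≡ replicate m x ++ replicate n x
replicate-+ zero    n x = refl
replicate-+ (suc m) n x = cong (x ∷_) (replicate-+ m n x)

replicate-nonEmpty : ∀ {A : Set} {m} {x : A} → 1 ≤ m → replicate m x ≢ []
replicate-nonEmpty {m = suc _} _ ()

All-≡⇒replicate : ∀ {A : Set} {x : A} {xs : List A} → All (_≡ x) xs → xs ≡ replicate (length xs) x
All-≡⇒replicate []           = refl
All-≡⇒replicate (refl ∷ xs≡) = cong (_ ∷_) (All-≡⇒replicate xs≡)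

all-equal-or-distinct : ∀ {A : Set} → DecidableEquality A → (a : A) (xs : List A) →
                        All (_≡ a) xs ⊎ ∃[ b ] ∃[ ys ] (b ≢ a × xs ↭ b ∷ ys)
all-equal-or-distinct eq? a []       = inj₁ []
all-equal-or-distinct eq? a (x ∷ xs) with eq? x a | all-equal-or-distinct eq? a xs
... | no x≢a   | _                        = inj₂ (x , xs , x≢a , ↭-refl)
... | yes x≡a  | inj₁ xs≡a                = inj₁ (x≡a ∷ xs≡a)
... | yes refl | inj₂ (b , ys , b≢a , xs↭) = inj₂ (b , x ∷ ys , b≢a , ↭-trans (prep x xs↭) (swap x b ↭-refl))

slice : ∀ {A : Set} → ℕ → ℕ → List A → List A
slice i j xs = drop i (take j xs)

take-++-slice : ∀ {A : Set} {i j} (xs : List A) → i ≤ j → take i xs ++ slice i j xs ≡ take j xs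
take-++-slice {i = i} {j} xs i≤j = begin
  take i xs ++ slice i j xs                 ≡⟨ cong (λ m → take m xs ++ slice i j xs) (m≤n⇒m⊓n≡m i≤j) ⟨
  take (i ⊓ j) xs ++ slice i j xs           ≡⟨ cong (_++ slice i j xs) (take-take i j xs) ⟨
  take i (take j xs) ++ drop i (take j xs)  ≡⟨ take++drop≡id i (take j xs) ⟩
  take j xs                                 ∎
  where open ≡-Reasoning

↭-slice : ∀ {A : Set} {i j} (xs : List A) → i ≤ j → xs ↭ slice i j xs ++ take i xs ++ drop j xs
↭-slice {i = i} {j} xs i≤j = ↭-trans (↭-reflexive split) (shifts (take i xs) (slice i j xs))
  where
  open ≡-Reasoning
  split : xs ≡ take i xs ++ slice i j xs ++ drop j xs
  split = begin
    xs                                        ≡⟨ take++drop≡id j xs ⟨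
    take j xs ++ drop j xs                    ≡⟨ cong (_++ drop j xs) (take-++-slice xs i≤j) ⟨
    (take i xs ++ slice i j xs) ++ drop j xs  ≡⟨ ++-assoc (take i xs) _ _ ⟩
    take i xs ++ slice i j xs ++ drop j xs    ∎

length-slice : ∀ {A : Set} {i j} (xs : List A) → j ≤ length xs → length (slice i j xs) ≡ j ∸ i
length-slice {i = i} {j} xs j≤|xs| =
  trans (length-drop i (take j xs)) (cong (_∸ i) (trans (length-take j xs) (m≤n⇒m⊓n≡m j≤|xs|)))

σ-slice : ∀ {n i j} (S : Seq n) → i ≤ j → σ (take j S) ≡ σ (take i S) + σ (slice i j S)
σ-slice {i = i} {j} S i≤j = trans (cong σ (sym (take-++-slice S i≤j))) (σ-++ (take i S) (slice i j S))

m%n≡[m+o]%n⇒n∣o : ∀ m o {n} .{{_ : NonZero n}} → m % n ≡ (m + o) % n → n ∣ o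
m%n≡[m+o]%n⇒n∣o m o {n} ≡mod =
  ∣m+n∣m⇒∣n (divides ((m + o) / n) (+-cancelˡ-≡ (m % n) _ _ shifted)) (n∣m*n (m / n))
  where
  open ≡-Reasoning
  shifted : m % n + (m / n * n + o) ≡ m % n + (m + o) / n * n
  shifted = begin
    m % n + (m / n * n + o)        ≡⟨ +-assoc (m % n) _ o ⟨
    m % n + m / n * n + o          ≡⟨ cong (_+ o) (m≡m%n+[m/n]*n m n) ⟨
    m + o                          ≡⟨ m≡m%n+[m/n]*n (m + o) n ⟩
    (m + o) % n + (m + o) / n * n  ≡⟨ cong (_+ (m + o) / n * n) ≡mod ⟨
    m % n + (m + o) / n * n        ∎

distinct⇒1<n : ∀ {n} {a b : Fin n} → a ≢ b → 1 < n
distinct⇒1<n {suc zero}    {zero} {zero} a≢b = contradiction refl a≢b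
distinct⇒1<n {suc (suc _)} _                 = s≤s (s≤s z≤n)

generator : ∀ n .{{_ : NonZero n}} → ∃ λ (g : Fin n) → HasOrder g n
generator (suc zero)    = zero , s≤s z≤n , 1∣ 0 , λ _ 1≤m _ → 1≤m
generator (suc (suc n)) = suc zero , s≤s z≤n , m∣m*n 1 , minimal
  where
  minimal : ∀ m → 1 ≤ m → MulZero m (suc zero) → suc (suc n) ≤ m
  minimal m 1≤m n∣m*1 = ∣⇒≤ {{>-nonZero 1≤m}} (subst (_ ∣_) (*-identityʳ m) n∣m*1)

module _ {n : ℕ} .{{_ : NonZero n}} where

  HasOrder⇒∣ : ∀ {g : Fin n} {m} → HasOrder g n → MulZero m g → n ∣ m
  HasOrder⇒∣ {g} {m} (_ , _ , minimal) n∣mg with m % n in m%n≡r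
  ... | zero  = m%n≡0⇒n∣m m n m%n≡r
  ... | suc r = contradiction (minimal (suc r) (s≤s z≤n) n∣rg) (<⇒≱ (subst (_< n) m%n≡r (m%n<n m n)))
    where
    open ≡-Reasoning
    split : m * toℕ g ≡ m / n * n * toℕ g + suc r * toℕ g
    split = begin
      m * toℕ g                         ≡⟨ cong (_* toℕ g) (m≡m%n+[m/n]*n m n) ⟩
      (m % n + m / n * n) * toℕ g       ≡⟨ cong (λ x → (x + m / n * n) * toℕ g) m%n≡r ⟩
      (suc r + m / n * n) * toℕ g       ≡⟨ *-distribʳ-+ (toℕ g) (suc r) _ ⟩
      suc r * toℕ g + m / n * n * toℕ g ≡⟨ +-comm (suc r * toℕ g) _ ⟩
      m / n * n * toℕ g + suc r * toℕ g ∎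
    n∣rg : n ∣ suc r * toℕ g
    n∣rg = ∣m+n∣m⇒∣n (subst (n ∣_) split n∣mg) (n∣m*n*o (m / n) (toℕ g))

  order-dichotomy : (g : Fin n) → HasOrder g n ⊎ ∃[ i ] (1 ≤ i × i < n × MulZero i g)
  order-dichotomy g with any? (λ (i : Fin n) → (1 ≤? toℕ i) ×-dec (n ∣? toℕ i * toℕ g))
  ... | yes (i , 1≤i , n∣ig) = inj₂ (toℕ i , 1≤i , toℕ<n i , n∣ig)
  ... | no ∄i = inj₁ (>-nonZero⁻¹ n , m∣m*n (toℕ g) , minimal)
    where
    minimal : ∀ m → 1 ≤ m → MulZero m g → n ≤ m
    minimal m 1≤m n∣mg with n ≤? m
    ... | yes n≤m = n≤m
    ... | no  n≰m = contradiction (fromℕ< (≰⇒> n≰m) , subst (1 ≤_) (sym toℕ≡m) 1≤m ,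
                                    subst (λ x → n ∣ x * toℕ g) (sym toℕ≡m) n∣mg) ∄i
      where
      toℕ≡m : toℕ (fromℕ< (≰⇒> n≰m)) ≡ m
      toℕ≡m = toℕ-fromℕ< (≰⇒> n≰m)

  constant-NTZS-length : ∀ {g : Fin n} {T : Seq n} → HasOrder g n → All (_≡ g) T → NTZS T → n ≤ length T
  constant-NTZS-length {T = []}    _ _ ([]≢[] , _) = contradiction refl []≢[]
  constant-NTZS-length {g} {T@(_ ∷ _)} (_ , _ , minimal) T≡g (_ , zsT) =
    minimal (length T) (s≤s z≤n)
      (subst (n ∣_) (trans (cong σ (All-≡⇒replicate T≡g)) (σ-replicate (length T) g)) zsT)

  length-concat-≥ : ∀ {g : Fin n} {Ts : List (Seq n)} → HasOrder g n →
                    All (All (_≡ g)) Ts → All NTZS Ts → length Ts * n ≤ length (concat Ts)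
  length-concat-≥ ord [] [] = z≤n
  length-concat-≥ {Ts = T ∷ Ts} ord (T≡g ∷ Ts≡g) (ntzsT ∷ ntzs) =
    ≤-trans (+-mono-≤ (constant-NTZS-length ord T≡g ntzsT) (length-concat-≥ ord Ts≡g ntzs))
            (≤-reflexive (sym (length-++ T)))

  disjointZS-replicate-≤ : ∀ {g : Fin n} {m L} → HasOrder g n → HasDisjointZS m (replicate L g) → m * n ≤ L
  disjointZS-replicate-≤ {g} {L = L} ord (Ts , R , refl , ntzs , rep↭) = begin
    length Ts * n                   ≤⟨ length-concat-≥ ord (concat⁻ (++⁻ˡ (concat Ts) all≡g)) ntzs ⟩
    length (concat Ts)              ≤⟨ m≤m+n _ (length R) ⟩
    length (concat Ts) + length R   ≡⟨ length-++ (concat Ts) ⟨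
    length (concat Ts ++ R)         ≡⟨ ↭-length rep↭ ⟨
    length (replicate L g)          ≡⟨ length-replicate L ⟩
    L                               ∎
    where
    open ≤-Reasoning
    all≡g : All (_≡ g) (concat Ts ++ R)
    all≡g = All-resp-↭ rep↭ (replicate⁺ L refl)

  Dk-lower-bound : ∀ {k ℓ} → DkProperty n k ℓ → k * n ≤ ℓ
  Dk-lower-bound {ℓ = ℓ} Dk =
    let (g , ord) = generator n
    in disjointZS-replicate-≤ ord (Dk (replicate ℓ g) (≤-reflexive (sym (length-replicate ℓ))))

  HasShortZeroSum : Seq n → Set
  HasShortZeroSum S = ∃[ T ] ∃[ R ] (S ↭ T ++ R × NTZS T × length T < n)

  short-resp-↭ : ∀ {S S′ : Seq n} → S ↭ S′ → HasShortZeroSum S′ → HasShortZeroSum S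
  short-resp-↭ S↭S′ (T , R , S′↭ , ntzsT , |T|<n) = T , R , ↭-trans S↭S′ S′↭ , ntzsT , |T|<n

  residue : Seq n → Fin n
  residue S = σ S mod n

  residue-≡ : ∀ (S T : Seq n) → residue S ≡ residue T → σ S % n ≡ σ T % n
  residue-≡ S T e = begin
    σ S % n           ≡⟨ toℕ-fromℕ< (m%n<n (σ S) n) ⟨
    toℕ (residue S)   ≡⟨ cong toℕ e ⟩
    toℕ (residue T)   ≡⟨ toℕ-fromℕ< (m%n<n (σ T) n) ⟩
    σ T % n           ∎
    where open ≡-Reasoning

  residue-[_] : (x : Fin n) → residue [ x ] ≡ x
  residue-[ x ] = toℕ-injective (begin
    toℕ (residue [ x ])  ≡⟨ toℕ-fromℕ< (m%n<n (σ [ x ]) n) ⟩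
    (toℕ x + 0) % n      ≡⟨ cong (_% n) (+-identityʳ (toℕ x)) ⟩
    toℕ x % n            ≡⟨ m<n⇒m%n≡m (toℕ<n x) ⟩
    toℕ x                ∎)
    where open ≡-Reasoning

  congruent-prefixes⇒short : ∀ i j (S : Seq n) → i < j → j < n → j ≤ length S →
                             σ (take i S) % n ≡ σ (take j S) % n → HasShortZeroSum S
  congruent-prefixes⇒short i j S i<j j<n j≤|S| ≡mod =
    slice i j S , take i S ++ drop j S , ↭-slice S (<⇒≤ i<j) , (nonEmpty , zeroSum) , short
    where
    |slice|≡ : length (slice i j S) ≡ j ∸ i
    |slice|≡ = length-slice {i = i} S j≤|S|
    nonEmpty : slice i j S ≢ []
    nonEmpty slice≡[] = <⇒≢ (m<n⇒0<n∸m i<j) (trans (sym (cong length slice≡[])) |slice|≡)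
    zeroSum : ZeroSum (slice i j S)
    zeroSum = m%n≡[m+o]%n⇒n∣o _ _ (trans ≡mod (cong (_% n) (σ-slice S (<⇒≤ i<j))))
    short : length (slice i j S) < n
    short = subst (_< n) (sym |slice|≡) (≤-<-trans (m∸n≤m j i) j<n)

  -- Pigeonhole on the n prefix sums of S = a b x₃ … together with the first
  -- prefix sum of S′ = b a x₃ …; prefixes of length ≥ 2 of S and S′ have
  -- equal sums, and a collision of b with a would force a ≡ b.
  distinct⇒short : ∀ {a b : Fin n} xs → a ≢ b → n ≤ length (a ∷ b ∷ xs) →
                   HasShortZeroSum (a ∷ b ∷ xs)
  distinct⇒short {a} {b} xs a≢b n≤|S| = collision (pigeonhole ≤-refl residues)
    where
    S S′ : Seq n
    S  = a ∷ b ∷ xs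
    S′ = b ∷ a ∷ xs
    residues : Fin (suc n) → Fin n
    residues zero    = residue (take 1 S′)
    residues (suc j) = residue (take (toℕ j) S)
    from-S′ : ∀ i j → i < j → j < n → σ (take i S′) % n ≡ σ (take j S′) % n → HasShortZeroSum S
    from-S′ i j i<j j<n =
      short-resp-↭ (swap a b ↭-refl) ∘ congruent-prefixes⇒short i j S′ i<j j<n (≤-trans (<⇒≤ j<n) n≤|S|)
    swapped : ∀ j → j < n → residue (take 1 S′) ≡ residue (take j S) → HasShortZeroSum S
    swapped zero          _   e =
      from-S′ 0 1 (s≤s z≤n) (distinct⇒1<n a≢b) (sym (residue-≡ (take 1 S′) [] e))
    swapped (suc zero)    _   e =
      contradiction (trans (sym residue-[ a ]) (trans (sym e) residue-[ b ])) a≢b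
    swapped (suc (suc j)) j<n e =
      from-S′ 1 (suc (suc j)) (s≤s (s≤s z≤n)) j<n
        (trans (residue-≡ (take 1 S′) (take (suc (suc j)) S) e)
               (cong (_% n) (σ-↭ (swap a b (↭-refl {x = take j xs})))))
    collision : (∃₂ λ i j → i <ᶠ j × residues i ≡ residues j) → HasShortZeroSum S
    collision (zero  , suc j , _   , e) = swapped (toℕ j) (toℕ<n j) e
    collision (suc i , suc j , i<j , e) =
      congruent-prefixes⇒short (toℕ i) (toℕ j) S (s≤s⁻¹ i<j) (toℕ<n j) (≤-trans (<⇒≤ (toℕ<n j)) n≤|S|)
        (residue-≡ (take (toℕ i) S) (take (toℕ j) S) e)

  replicate-short : ∀ {g : Fin n} {i m} → 1 ≤ i → i < n → MulZero i g → i ≤ m → HasShortZeroSum (replicate m g)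
  replicate-short {g} {i} {m} 1≤i i<n n∣ig i≤m =
    replicate i g , replicate (m ∸ i) g , ↭-reflexive split , (replicate-nonEmpty 1≤i , zeroSum) ,
    subst (_< n) (sym (length-replicate i)) i<n
    where
    split : replicate m g ≡ replicate i g ++ replicate (m ∸ i) g
    split = trans (cong (λ x → replicate x g) (sym (m+[n∸m]≡n i≤m))) (replicate-+ i (m ∸ i) g)
    zeroSum : ZeroSum (replicate i g)
    zeroSum = subst (n ∣_) (sym (σ-replicate i g)) n∣ig

  short-or-generator-power : (S : Seq n) → n ≤ length S →
                             HasShortZeroSum S ⊎ ∃[ g ] (HasOrder g n × S ≡ replicate (length S) g)
  short-or-generator-power [] n≤0 = contradiction n≤0 (<⇒≱ (>-nonZero⁻¹ n))
  short-or-generator-power (a ∷ xs) n≤|S| with all-equal-or-distinct _≟_ a xs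
  ... | inj₂ (b , ys , b≢a , xs↭) =
    inj₁ (short-resp-↭ (prep a xs↭)
           (distinct⇒short ys (b≢a ∘ sym) (≤-trans n≤|S| (≤-reflexive (↭-length (prep a xs↭))))))
  ... | inj₁ xs≡a with order-dichotomy a
  ...   | inj₁ ord = inj₂ (a , ord , All-≡⇒replicate (refl ∷ xs≡a))
  ...   | inj₂ (i , 1≤i , i<n , n∣ia) =
    inj₁ (subst HasShortZeroSum (sym (All-≡⇒replicate (refl ∷ xs≡a)))
                (replicate-short 1≤i i<n n∣ia (≤-trans (<⇒≤ i<n) n≤|S|)))

  replicate-partition : ∀ (g : Fin n) j c → suc j ≤ c → PartitionableInto (suc j) (replicate (c * n) g)
  replicate-partition g zero    (suc c) _ =
    partition-singleton
      (replicate-nonEmpty (≤-trans (>-nonZero⁻¹ n) (m≤m+n n (c * n))) , ZeroSum-replicate g (n∣m*n (suc c)))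
  replicate-partition g (suc j) (suc c) (s≤s j<c) =
    subst (PartitionableInto _) (sym (replicate-+ n (c * n) g))
          (partition-∷ (replicate-nonEmpty (>-nonZero⁻¹ n) , ZeroSum-replicate g ∣-refl)
                       (replicate-partition g j c j<c))

  generator-power-partition-or-exact : ∀ k {g : Fin n} {S : Seq n} → HasOrder g n →
                                       S ≡ replicate (length S) g → ZeroSum S → k * n ≤ length S →
                                       PartitionableInto (suc k) S ⊎ S ↭ replicate (k * n) g
  generator-power-partition-or-exact k {g} {S} ord S≡ zsS kn≤|S| =
    Sum.map (λ k<c → partition-resp-↭ (↭-reflexive S≡c) (replicate-partition g k c k<c))
            (λ k≡c → ↭-reflexive (trans S≡c (cong (λ x → replicate (x * n) g) (sym k≡c))))
            (m≤n⇒m<n∨m≡n k≤c)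
    where
    n∣|S| : n ∣ length S
    n∣|S| = HasOrder⇒∣ ord (subst (n ∣_) (trans (cong σ S≡) (σ-replicate (length S) g)) zsS)
    c : ℕ
    c = quotient n∣|S|
    S≡c : S ≡ replicate (c * n) g
    S≡c = trans S≡ (cong (λ x → replicate x g) (m∣n⇒n≡quotient*m n∣|S|))
    k≤c : k ≤ c
    k≤c = *-cancelʳ-≤ k c n (subst (k * n ≤_) (m∣n⇒n≡quotient*m n∣|S|) kn≤|S|)

  partition-or-generator-power : ∀ k (S : Seq n) → ZeroSum S → k * n ≤ length S →
                                 PartitionableInto (suc k) S ⊎ ∃[ g ] (HasOrder g n × S ↭ replicate (k * n) g)
  short⇒partition : ∀ k {S : Seq n} → ZeroSum S → suc k * n ≤ length S → HasShortZeroSum S →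
                    PartitionableInto (suc (suc k)) S

  partition-or-generator-power zero    []          _   _ = inj₂ (Product.map₂ (_, ↭-refl) (generator n))
  partition-or-generator-power zero    S@(_ ∷ _)   zsS _ = inj₁ (partition-singleton ((λ ()) , zsS))
  partition-or-generator-power (suc k) S zsS kn≤|S|
    with short-or-generator-power S (≤-trans (m≤m+n n (k * n)) kn≤|S|)
  ... | inj₁ short          = inj₁ (short⇒partition k zsS kn≤|S| short)
  ... | inj₂ (g , ord , S≡) =
    Sum.map₂ (λ S↭ → g , ord , S↭) (generator-power-partition-or-exact (suc k) ord S≡ zsS kn≤|S|)

  short⇒partition k {S} zsS kn≤|S| (T , R , S↭T++R , ntzsT@(_ , zsT) , |T|<n) =
    extend (partition-or-generator-power k R zsR (<⇒≤ kn<|R|))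
    where
    zsR : ZeroSum R
    zsR = ZeroSum-++⁻ʳ T zsT (subst (n ∣_) (σ-↭ S↭T++R) zsS)
    kn<|R| : k * n < length R
    kn<|R| = +-cancelˡ-< n _ _ (≤-<-trans kn≤|S| (subst (_< n + length R) (sym |S|≡)
                                                    (+-monoˡ-< (length R) |T|<n)))
      where
      |S|≡ : length S ≡ length T + length R
      |S|≡ = trans (↭-length S↭T++R) (length-++ T)
    extend : PartitionableInto (suc k) R ⊎ ∃[ g ] (HasOrder g n × R ↭ replicate (k * n) g) →
             PartitionableInto (suc (suc k)) S
    extend (inj₁ partR)        = partition-resp-↭ S↭T++R (partition-∷ ntzsT partR)
    extend (inj₂ (_ , _ , R↭)) = contradiction (trans (↭-length R↭) (length-replicate (k * n))) (>⇒≢ kn<|R|)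

theorem3p2 : (n : ℕ) → 1 ≤ n → (k : ℕ) → 1 ≤ k → (ℓ : ℕ) → IsDk n k ℓ →
    (S : Seq n) → ZeroSum S → length S ≡ ℓ →
    (InMk k S ⇔ (∃[ g ] (HasOrder g n × S ↭ replicate (k * n) g)))
theorem3p2 n 1≤n k _ ℓ (Dk , _) S zsS |S|≡ℓ = mk⇔ forward backward
  where
  instance
    n≢0 : NonZero n
    n≢0 = >-nonZero 1≤n
  forward : InMk k S → ∃[ g ] (HasOrder g n × S ↭ replicate (k * n) g)
  forward (_ , ¬partition) =
    [ flip contradiction ¬partition , id ]′
      (partition-or-generator-power k S zsS (subst (k * n ≤_) (sym |S|≡ℓ) (Dk-lower-bound Dk)))
  backward : ∃[ g ] (HasOrder g n × S ↭ replicate (k * n) g) → InMk k S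
  backward (g , ord , S↭) = zsS , λ partition →
    <⇒≱ (m<n+m (k * n) 1≤n)
        (disjointZS-replicate-≤ ord (partition⇒disjointZS (partition-resp-↭ (↭-sym S↭) partition)))
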